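{- Let $L^{\mathrm{trap}}=\{w\in\{0,1\}^*\mid |w|_0=|w|_1=4,\ \delta_{1,1}^{4}(w)\in\{0101,1010,0110,1001\}\ \text{or}\ \delta_{2,2}^{4}(w)\in\{0101,1010,0110,1001\}\}\cup\{00111100,11000011\}$. Then $\mathcal{G}_{L^{\mathrm{trap}}}$ is exactly the class of trapezoid graphs.
   Context: $|w|_a$ is the number of occurrences of letter $a$ in $w$. For a binary word $w$ with four $0$s and four $1$s, $\delta_{1,1}^4(w)$ keeps only the first two $0$s and first two $1$s (deleting the others), and $\delta_{2,2}^4(w)$ keeps only the third and fourth $0$ and the third and fourth $1$. For a word $w$ and distinct letters $a,b$, $h_{a,b}(w)$ replaces $a$ by $0$, $b$ by $1$ and deletes other letters. For $L\subseteq\{0,1\}^*$ closed under exchanging $0$ and $1$ and a word $w$ with letter set $V$, $G(L,w)$ is the graph on $V$ where distinct $u,v$ are adjacent iff $h_{u,v}(w)\in L$; $\mathcal{G}_L$ is the class of graphs isomorphic to some $G(L,w)$. A trapezoid graph is the intersection graph of a family of trapezoids between two fixed parallel lines, each trapezoid being the convex hull of a closed interval on the first line and a closed interval on the second line.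
   Formalization: The closed intervals spanning each trapezoid have rational endpoints rather than real ones, so the trapezoids are point sets in ℚ². -}

module Defs where

open import Data.Bool using (Bool; true; false; if_then_else_)
open import Data.Nat using (ℕ; zero; suc; _≤ᵇ_)
open import Data.Fin using (Fin; _≟_)
open import Data.List using (List; []; _∷_; length; filter)
open import Data.List.Membership.Propositional using (_∈_)
open import Data.Product using (Σ; ∃; ∃-syntax; _×_; _,_)
open import Data.Sum using (_⊎_)
open import Data.Rational using (ℚ; 0ℚ; 1ℚ; _+_; _*_; _-_; _≤_)
open import Relation.Binary.PropositionalEquality using (_≡_; _≢_)
open import Relation.Nullary using (yes; no; ¬_)
open import Function.Bundles using (_⇔_; _↔_; Inverse)
open import Data.Empty using (⊥)

-- Binary words: letter 0 is `false`, letter 1 is `true`.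

Binary : Set
Binary = List Bool

count0 : Binary → ℕ
count0 []          = 0
count0 (false ∷ w) = suc (count0 w)
count0 (true  ∷ w) = count0 w

count1 : Binary → ℕ
count1 []          = 0
count1 (false ∷ w) = count1 w
count1 (true  ∷ w) = suc (count1 w)

-- Keep the k-th occurrence (1-based) of each letter iff `keep k = true`.
-- c0 / c1 count the occurrences of 0 / 1 seen so far.
keepOcc : (ℕ → Bool) → ℕ → ℕ → Binary → Binary
keepOcc keep c0 c1 [] = []
keepOcc keep c0 c1 (false ∷ w) =
  if keep (suc c0) then false ∷ keepOcc keep (suc c0) c1 w
                   else keepOcc keep (suc c0) c1 w
keepOcc keep c0 c1 (true ∷ w) =
  if keep (suc c1) then true ∷ keepOcc keep c0 (suc c1) w
                   else keepOcc keep c0 (suc c1) w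

δ₁₁ : Binary → Binary
δ₁₁ = keepOcc (λ k → k ≤ᵇ 2) 0 0

δ₂₂ : Binary → Binary
δ₂₂ = keepOcc (λ k → if 3 ≤ᵇ k then k ≤ᵇ 4 else false) 0 0

Alt : List Binary
Alt = (false ∷ true ∷ false ∷ true ∷ [])
    ∷ (true ∷ false ∷ true ∷ false ∷ [])
    ∷ (false ∷ true ∷ true ∷ false ∷ [])
    ∷ (true ∷ false ∷ false ∷ true ∷ [])
    ∷ []

w00111100 w11000011 : Binary
w00111100 = false ∷ false ∷ true ∷ true ∷ true ∷ true ∷ false ∷ false ∷ []
w11000011 = true ∷ true ∷ false ∷ false ∷ false ∷ false ∷ true ∷ true ∷ []

LTrap : Binary → Set
LTrap w =
  (count0 w ≡ 4 × count1 w ≡ 4 × (δ₁₁ w ∈ Alt ⊎ δ₂₂ w ∈ Alt))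
  ⊎ (w ≡ w00111100 ⊎ w ≡ w11000011)

h : {k : ℕ} → Fin k → Fin k → List (Fin k) → Binary
h a b [] = []
h a b (x ∷ w) with x ≟ a | x ≟ b
... | yes _ | _     = false ∷ h a b w
... | no _  | yes _ = true ∷ h a b w
... | no _  | no _  = h a b w

WordAdj : (L : Binary → Set) {k : ℕ} → List (Fin k) → Fin k → Fin k → Set
WordAdj L w u v = u ≢ v × L (h u v w)

record Graph : Set₁ where
  field
    n     : ℕ
    Adj   : Fin n → Fin n → Set
    sym   : ∀ {u v} → Adj u v → Adj v u
    irrefl : ∀ {u} → ¬ Adj u u
open Graph public

-- G ∈ 𝒢_L : G is isomorphic to G(L, w) for some word w; the letter set of
-- w is Fin k (every element of Fin k occurs in w).
InClass : (L : Binary → Set) → Graph → Set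
InClass L G =
  ∃[ k ] Σ (List (Fin k)) λ w → (∀ (i : Fin k) → i ∈ w) ×
    Σ (Fin (n G) ↔ Fin k) λ f →
      ∀ (u v : Fin (n G)) → Adj G u v ⇔ WordAdj L w (Inverse.to f u) (Inverse.to f v)

-- Trapezoids between the parallel lines y = 0 and y = 1 (coordinates in ℚ).
-- Top interval [a,b] on y = 0, bottom interval [c,d] on y = 1.

record Trapezoid : Set where
  field
    a b c d : ℚ
    a≤b : a ≤ b
    c≤d : c ≤ d
open Trapezoid public

-- (x , t) belongs to the convex hull of [a,b]×{0} ∪ [c,d]×{1}:
-- 0 ≤ t ≤ 1 and x = (1 - t) p + t q with p ∈ [a,b], q ∈ [c,d].
_∈T_ : ℚ × ℚ → Trapezoid → Set
(x , t) ∈T T =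
  (0ℚ ≤ t × t ≤ 1ℚ) ×
  ∃[ p ] ∃[ q ] ((a T ≤ p × p ≤ b T) × (c T ≤ q × q ≤ d T) ×
                 x ≡ (1ℚ - t) * p + t * q)

Intersect : Trapezoid → Trapezoid → Set
Intersect T T′ = ∃[ z ] (z ∈T T × z ∈T T′)

IsTrapezoidGraph : Graph → Set
IsTrapezoidGraph G =
  Σ (Fin (n G) → Trapezoid) λ T →
    ∀ (u v : Fin (n G)) → u ≢ v → (Adj G u v ⇔ Intersect (T u) (T v))

-- A word with four 0s and four 1s codes two trapezoids: the positions of the first two 0s are
-- the top interval and those of the last two 0s the bottom interval of the first one, and
-- likewise for the 1s. Two trapezoids are disjoint exactly when one lies strictly to the left
-- of the other on both lines, and a check of all words of length 8 shows that L^trap consists of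
-- the words whose two trapezoids are not separated in this way. So the letters of a word w, each
-- taking the trapezoid of its four positions (letters occurring otherwise are isolated and
-- become distinct points), form a trapezoid representation of G(L^trap, w). Conversely, listing
-- the endpoints of a family of trapezoids from left to right, the top line before the bottom
-- line and left endpoints before right endpoints at equal values, gives a word w whose
-- restriction h_{u,v}(w) codes the relative position of the trapezoids of u and v.
module Submission where

open import Defs hiding (sym)
open import Data.Bool using (Bool; true; false; not; _∧_; T; if_then_else_)
open import Data.Bool.Properties using (T?; T-∧) renaming (_≟_ to _≟ᵇ_)
open import Data.Empty using (⊥-elim)
open import Data.Fin using (Fin; toℕ; fromℕ<; _≟_)
open import Data.Fin.Properties using (toℕ<n; toℕ-fromℕ<; toℕ-injective)
open import Data.Integer using (+_; +<+; +≤+)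
import Data.Integer as ℤ
open import Data.Integer.Properties using (*-identityʳ; drop‿+<+)
open import Data.List using (List; []; _∷_; [_]; length; map; filter; filterᵇ; _++_; allFin)
open import Data.List.Properties using (≡-dec; length-filter)
open import Data.List.Membership.Propositional using (_∈_; _∉_)
open import Data.List.Membership.Propositional.Properties
  using (∈-++⁺ˡ; ∈-++⁺ʳ; ∈-map⁺; ∈-map⁻; ∈-filter⁺; ∈-filter⁻; ∈-allFin)
open import Data.List.Relation.Unary.All as All using (All; all?)
open import Data.List.Relation.Unary.Any using (here; there)
open import Data.Product using (Σ; ∃-syntax; _×_; _,_; proj₁; proj₂)
open import Data.Product.Function.NonDependent.Propositional using (_×-⇔_)
open import Data.Rational as ℚ using (ℚ; mkℚ; *<*; *≤*)
import Data.Rational.Properties as ℚ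
open import Data.Rational.Properties using (_<?_)
open import Data.Sum using (inj₁; inj₂)
open import Data.Unit using (⊤; tt)
open import Function using (_∘_)
open import Function.Bundles using (_⇔_; mk⇔; Equivalence; Inverse; Injection)
open import Function.Properties.Equivalence using (⇔-setoid) renaming (trans to ⇔-trans; sym to ⇔-sym)
open import Function.Properties.Inverse using (↔-refl; ↔⇒↣)
open import Function.Related.TypeIsomorphisms using (¬-cong-⇔)
open import Level using (0ℓ)
open import Relation.Binary.Definitions using (tri<; tri≈; tri>)
open import Relation.Binary.PropositionalEquality using (_≡_; _≢_; refl; sym; trans; cong; cong₂; subst; subst₂)
open import Relation.Nullary using (¬_; ¬?; yes; no)
open import Relation.Nullary.Decidable using (⌊_⌋; toWitness; fromWitness; from-yes; _×-dec_; _⊎-dec_; _→-dec_)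
open import Relation.Unary using (Decidable)

empty⇔empty : ∀ {A B : Set} → ¬ A → ¬ B → A ⇔ B
empty⇔empty ¬A ¬B = mk⇔ (⊥-elim ∘ ¬A) (⊥-elim ∘ ¬B)

module Geometry where

  open import Data.Rational using (0ℚ; 1ℚ; _+_; _*_; _-_; -_; _≤_; _<_; _⊔_; 1/_; Positive; positive; nonNegative)
  open import Data.Rational.Properties
    using (≤-refl; <⇒≤; ≮⇒≥; ≤-<-trans; <-≤-trans; <-irrefl; p≤p⊔q; p≤q⊔p; ⊔-lub;
           +-inverseʳ; +-identityˡ; +-monoˡ-<; +-monoˡ-≤; +-mono-<; +-mono-<-≤; +-mono-≤-<;
           *-monoʳ-<-pos; *-monoˡ-≤-nonNeg; *-inverseʳ; pos⇒nonZero; 1/pos⇒pos; pos*pos⇒pos; positive⁻¹)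
  open import Data.Rational.Solver using (module +-*-Solver)
  open +-*-Solver

  _◁_ : Trapezoid → Trapezoid → Set
  S ◁ S′ = b S < a S′ × d S < c S′

  Intersect-sym : ∀ {S S′} → Intersect S S′ → Intersect S′ S
  Intersect-sym (z , z∈S , z∈S′) = z , z∈S′ , z∈S

  p<q⇒0<q-p : ∀ {p q} → p < q → 0ℚ < q - p
  p<q⇒0<q-p {p} {q} p<q = subst (_< q - p) (+-inverseʳ p) (+-monoˡ-< (- p) p<q)

  p≤q⇒0≤q-p : ∀ {p q} → p ≤ q → 0ℚ ≤ q - p
  p≤q⇒0≤q-p {p} {q} p≤q = subst (_≤ q - p) (+-inverseʳ p) (+-monoˡ-≤ (- p) p≤q)

  0≤q-p⇒p≤q : ∀ {p q} → 0ℚ ≤ q - p → p ≤ q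
  0≤q-p⇒p≤q {p} {q} 0≤q-p = subst₂ _≤_ (+-identityˡ p) (q-p+p≡q q p) (+-monoˡ-≤ p 0≤q-p)
    where
    q-p+p≡q : ∀ x y → (x - y) + y ≡ x
    q-p+p≡q = solve 2 (λ x y → (x :- y) :+ y := x) refl

  convex-mono-< : ∀ {t p p′ q q′} → 0ℚ ≤ t → t ≤ 1ℚ → p < p′ → q < q′ →
                  (1ℚ - t) * p + t * q < (1ℚ - t) * p′ + t * q′
  convex-mono-< {t} 0≤t t≤1 p<p′ q<q′ with t <? 1ℚ
  ... | yes t<1 = +-mono-<-≤ (*-monoʳ-<-pos (1ℚ - t) {{positive (p<q⇒0<q-p t<1)}} p<p′)
                             (*-monoˡ-≤-nonNeg t {{nonNegative 0≤t}} (<⇒≤ q<q′))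
  ... | no t≮1  = +-mono-≤-< (*-monoˡ-≤-nonNeg (1ℚ - t) {{nonNegative (p≤q⇒0≤q-p t≤1)}} (<⇒≤ p<p′))
                             (*-monoʳ-<-pos t {{positive (<-≤-trans (positive⁻¹ 1ℚ) (≮⇒≥ t≮1))}} q<q′)

  Intersect⇒¬◁ : ∀ {S S′} → Intersect S S′ → ¬ S ◁ S′
  Intersect⇒¬◁ ((x , t) , ((0≤t , t≤1) , p , q , (_ , p≤b) , (_ , q≤d) , x≡) ,
                          (_ , p′ , q′ , (a′≤p′ , _) , (c′≤q′ , _) , x≡′)) (b<a′ , d<c′) =
    <-irrefl (trans (sym x≡) x≡′)
      (convex-mono-< 0≤t t≤1 (≤-<-trans p≤b (<-≤-trans b<a′ a′≤p′)) (≤-<-trans q≤d (<-≤-trans d<c′ c′≤q′)))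

  top-point : ∀ S {p} → a S ≤ p → p ≤ b S → (p , 0ℚ) ∈T S
  top-point S {p} a≤p p≤b =
    (≤-refl , <⇒≤ (positive⁻¹ 1ℚ)) , p , c S , (a≤p , p≤b) , (≤-refl , c≤d S) , at-top p (c S)
    where
    at-top : ∀ x y → x ≡ (1ℚ - 0ℚ) * x + 0ℚ * y
    at-top = solve 2 (λ x y → x := (con 1ℚ :- con 0ℚ) :* x :+ con 0ℚ :* y) refl

  bottom-point : ∀ S {q} → c S ≤ q → q ≤ d S → (q , 1ℚ) ∈T S
  bottom-point S {q} c≤q q≤d =
    (<⇒≤ (positive⁻¹ 1ℚ) , ≤-refl) , a S , q , (≤-refl , a≤b S) , (c≤q , q≤d) , at-bottom (a S) q
    where
    at-bottom : ∀ x y → y ≡ (1ℚ - 1ℚ) * x + 1ℚ * y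
    at-bottom = solve 2 (λ x y → y := (con 1ℚ :- con 1ℚ) :* x :+ con 1ℚ :* y) refl

  top-overlap : ∀ S S′ → a S′ ≤ b S → a S ≤ b S′ → Intersect S S′
  top-overlap S S′ a′≤b a≤b′ =
    (a S ⊔ a S′ , 0ℚ) , top-point S  (p≤p⊔q (a S) (a S′)) (⊔-lub (a≤b S) a′≤b)
                      , top-point S′ (p≤q⊔p (a S) (a S′)) (⊔-lub a≤b′ (a≤b S′))

  bottom-overlap : ∀ S S′ → c S′ ≤ d S → c S ≤ d S′ → Intersect S S′
  bottom-overlap S S′ c′≤d c≤d′ =
    (c S ⊔ c S′ , 1ℚ) , bottom-point S  (p≤p⊔q (c S) (c S′)) (⊔-lub (c≤d S) c′≤d)
                      , bottom-point S′ (p≤q⊔p (c S) (c S′)) (⊔-lub c≤d′ (c≤d S′))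

  proportional-weights : ∀ α β .{{_ : Positive α}} .{{_ : Positive β}} →
                         ∃[ ι ] (0ℚ ≤ α * ι × α * ι ≤ 1ℚ × 1ℚ - α * ι ≡ β * ι)
  proportional-weights α β = ι , 0≤t , t≤1 , 1-t≡βι
    where
    instance
      α+β-pos : Positive (α + β)
      α+β-pos = positive (+-mono-< (positive⁻¹ α) (positive⁻¹ β))
      α+β-nonZero : ℚ.NonZero (α + β)
      α+β-nonZero = pos⇒nonZero (α + β)
      ι-pos : Positive (1/ (α + β))
      ι-pos = 1/pos⇒pos (α + β)
    ι : ℚ
    ι = 1/ (α + β)
    1-t≡βι : 1ℚ - α * ι ≡ β * ι
    1-t≡βι = trans (cong (_- α * ι) (sym (*-inverseʳ (α + β)))) (distrib α β ι)
      where
      distrib : ∀ x y z → (x + y) * z - x * z ≡ y * z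
      distrib = solve 3 (λ x y z → (x :+ y) :* z :- x :* z := y :* z) refl
    0≤t : 0ℚ ≤ α * ι
    0≤t = <⇒≤ (positive⁻¹ (α * ι) {{pos*pos⇒pos α ι}})
    t≤1 : α * ι ≤ 1ℚ
    t≤1 = 0≤q-p⇒p≤q (subst (0ℚ ≤_) (sym 1-t≡βι) (<⇒≤ (positive⁻¹ (β * ι) {{pos*pos⇒pos β ι}})))

  -- The diagonal from (b S, 0) to (c S, 1) meets the diagonal from (a S′, 0) to (d S′, 1)
  -- at height α / (α + β), where α and β are the gaps on the two lines.
  crossing : ∀ S S′ → b S < a S′ → d S′ < c S → Intersect S S′
  crossing S S′ b<a′ d′<c =
    (x , t) , ((0≤t , t≤1) , b S , c S , (a≤b S , ≤-refl) , (≤-refl , c≤d S) , refl)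
            , ((0≤t , t≤1) , a S′ , d S′ , (≤-refl , a≤b S′) , (c≤d S′ , ≤-refl) , same-x)
    where
    α β : ℚ
    α = a S′ - b S
    β = c S - d S′
    weights : ∃[ ι ] (0ℚ ≤ α * ι × α * ι ≤ 1ℚ × 1ℚ - α * ι ≡ β * ι)
    weights = proportional-weights α β {{positive (p<q⇒0<q-p b<a′)}} {{positive (p<q⇒0<q-p d′<c)}}
    ι t x : ℚ
    ι = proj₁ weights
    t = α * ι
    x = (1ℚ - t) * b S + t * c S
    0≤t : 0ℚ ≤ t
    0≤t = proj₁ (proj₂ weights)
    t≤1 : t ≤ 1ℚ
    t≤1 = proj₁ (proj₂ (proj₂ weights))
    1-t≡βι : 1ℚ - t ≡ β * ι
    1-t≡βι = proj₂ (proj₂ (proj₂ weights))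
    same-x : x ≡ (1ℚ - t) * a S′ + t * d S′
    same-x = begin
      (1ℚ - t) * b S + t * c S     ≡⟨ cong (λ s → s * b S + t * c S) 1-t≡βι ⟩
      β * ι * b S + α * ι * c S    ≡⟨ cross (b S) (c S) (a S′) (d S′) ι ⟩
      β * ι * a S′ + α * ι * d S′  ≡⟨ cong (λ s → s * a S′ + t * d S′) (sym 1-t≡βι) ⟩
      (1ℚ - t) * a S′ + t * d S′   ∎
      where
      open Relation.Binary.PropositionalEquality.≡-Reasoning
      cross : ∀ p q p′ q′ z → (q - q′) * z * p + (p′ - p) * z * q ≡ (q - q′) * z * p′ + (p′ - p) * z * q′
      cross = solve 5 (λ p q p′ q′ z → (q :- q′) :* z :* p :+ (p′ :- p) :* z :* q
                                      := (q :- q′) :* z :* p′ :+ (p′ :- p) :* z :* q′) refl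

  -- If neither trapezoid lies left of the other, they overlap on one of the lines or they cross.
  ¬◁⇒Intersect : ∀ S S′ → ¬ S ◁ S′ → ¬ S′ ◁ S → Intersect S S′
  ¬◁⇒Intersect S S′ S⋪S′ S′⋪S with b S <? a S′ | b S′ <? a S | d S <? c S′ | d S′ <? c S
  ... | no b≮a′  | no b′≮a  | _        | _        = top-overlap S S′ (≮⇒≥ b≮a′) (≮⇒≥ b′≮a)
  ... | _        | _        | no d≮c′  | no d′≮c  = bottom-overlap S S′ (≮⇒≥ d≮c′) (≮⇒≥ d′≮c)
  ... | yes b<a′ | _        | yes d<c′ | _        = ⊥-elim (S⋪S′ (b<a′ , d<c′))
  ... | _        | yes b′<a | _        | yes d′<c = ⊥-elim (S′⋪S (b′<a , d′<c))
  ... | yes b<a′ | _        | no _     | yes d′<c = crossing S S′ b<a′ d′<c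
  ... | no _     | yes b′<a | yes d<c′ | no _     = Intersect-sym {S′} {S} (crossing S′ S b′<a d<c′)

  Intersect⇔¬◁ : ∀ S S′ → Intersect S S′ ⇔ (¬ S ◁ S′ × ¬ S′ ◁ S)
  Intersect⇔¬◁ S S′ = mk⇔ (λ i → Intersect⇒¬◁ {S} {S′} i , Intersect⇒¬◁ {S′} {S} (Intersect-sym {S} {S′} i))
                          (λ (S⋪S′ , S′⋪S) → ¬◁⇒Intersect S S′ S⋪S′ S′⋪S)

open Geometry

-- Imported only now, so that Geometry uses the order of ℚ unqualified.
open import Data.Nat using (ℕ; zero; suc; _+_; _*_; _≤_; _<_; z≤n; s≤s; z<s; s<s; NonZero; _%_)
open import Data.Nat.Coprimality using (1-coprimeTo) renaming (sym to coprime-sym)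
open import Data.Nat.DivMod using ([m+kn]%n≡m%n; m<n⇒m%n≡m; m%n<n)
open import Data.Nat.Properties
  using (≤-refl; ≤-trans; <⇒≤; <⇒≱; <-trans; <-≤-trans; <-irrefl; <-asym; <-cmp; ≤∧≢⇒<; n≤1+n; n<1+n;
         m≤n⇒m≤1+n; m<n⇒m<1+n; m≤m+n; m≤n+m; +-identityʳ; +-suc; +-monoˡ-<; +-monoʳ-<; +-monoʳ-≤;
         +-cancelˡ-<; +-cancelˡ-≡; *-monoʳ-≤; *-monoˡ-≤; *-cancelˡ-<; *-suc; even≢odd)
  renaming (_≟_ to _≟ℕ_)

-- The language L^trap

-- Whether the i-th 0 of w comes before its j-th 1, counting from 0.
occ₀<occ₁ : Binary → ℕ → ℕ → Bool
occ₀<occ₁ []          i       j       = false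
occ₀<occ₁ (false ∷ w) zero    j       = true
occ₀<occ₁ (false ∷ w) (suc i) j       = occ₀<occ₁ w i j
occ₀<occ₁ (true ∷ w)  i       zero    = false
occ₀<occ₁ (true ∷ w)  i       (suc j) = occ₀<occ₁ w i j

-- The four 0s of w, in order, are read as the endpoints a, b, c, d of one trapezoid and the
-- four 1s as those of another; this says that the first lies left of the second.
zeroes◁ones : Binary → Bool
zeroes◁ones w = occ₀<occ₁ w 1 0 ∧ occ₀<occ₁ w 3 2

exchange : Binary → Binary
exchange = map not

Unseparated : Binary → Set
Unseparated w = ¬ T (zeroes◁ones w) × ¬ T (zeroes◁ones (exchange w))

ltrap? : Decidable LTrap
ltrap? w = (count0 w ≟ℕ 4 ×-dec count1 w ≟ℕ 4 ×-dec (δ₁₁ w ∈? Alt ⊎-dec δ₂₂ w ∈? Alt))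
         ⊎-dec (≡-dec _≟ᵇ_ w w00111100 ⊎-dec ≡-dec _≟ᵇ_ w w11000011)
  where open import Data.List.Membership.DecPropositional (≡-dec _≟ᵇ_) using (_∈?_)

words : ℕ → List Binary
words zero    = [ [] ]
words (suc n) = map (false ∷_) (words n) ++ map (true ∷_) (words n)

∈-words : ∀ w → w ∈ words (length w)
∈-words []          = here refl
∈-words (false ∷ w) = ∈-++⁺ˡ (∈-map⁺ (false ∷_) (∈-words w))
∈-words (true ∷ w)  = ∈-++⁺ʳ _ (∈-map⁺ (true ∷_) (∈-words w))

length≡count0+count1 : ∀ w → length w ≡ count0 w + count1 w
length≡count0+count1 []          = refl
length≡count0+count1 (false ∷ w) = cong suc (length≡count0+count1 w)
length≡count0+count1 (true ∷ w)  = trans (cong suc (length≡count0+count1 w)) (sym (+-suc (count0 w) (count1 w)))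

-- Checked by evaluating the decision procedure on all 2⁸ words of length 8.
LTrap⇔Unseparated : ∀ w → count0 w ≡ 4 → count1 w ≡ 4 → LTrap w ⇔ Unseparated w
LTrap⇔Unseparated w c₀ c₁ = mk⇔ (proj₁ characterised) (proj₂ characterised)
  where
  Characterised : Binary → Set
  Characterised v = count0 v ≡ 4 → count1 v ≡ 4 → (LTrap v → Unseparated v) × (Unseparated v → LTrap v)
  unseparated? : Decidable Unseparated
  unseparated? v = ¬? (T? _) ×-dec ¬? (T? _)
  characterised? : Decidable Characterised
  characterised? v = count0 v ≟ℕ 4 →-dec count1 v ≟ℕ 4 →-dec
    ((ltrap? v →-dec unseparated? v) ×-dec (unseparated? v →-dec ltrap? v))
  |w|≡8 : length w ≡ 8
  |w|≡8 = trans (length≡count0+count1 w) (cong₂ _+_ c₀ c₁)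
  characterised : (LTrap w → Unseparated w) × (Unseparated w → LTrap w)
  characterised = All.lookup (from-yes (all? characterised? (words 8)))
                             (subst (λ n → w ∈ words n) |w|≡8 (∈-words w)) c₀ c₁

LTrap⇒count0≡4 : ∀ {w} → LTrap w → count0 w ≡ 4
LTrap⇒count0≡4 (inj₁ (c₀ , _))    = c₀
LTrap⇒count0≡4 (inj₂ (inj₁ refl)) = refl
LTrap⇒count0≡4 (inj₂ (inj₂ refl)) = refl

LTrap⇒count1≡4 : ∀ {w} → LTrap w → count1 w ≡ 4
LTrap⇒count1≡4 (inj₁ (_ , c₁ , _)) = c₁
LTrap⇒count1≡4 (inj₂ (inj₁ refl))  = refl
LTrap⇒count1≡4 (inj₂ (inj₂ refl))  = refl

-- Binary words marking two sets of positions

range : ℕ → ℕ → List ℕ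
range s zero    = []
range s (suc m) = s ∷ range (suc s) m

-- The word h_{x,y}(w) as seen from the positions of w: p marks the positions of x and q those of y.
marks : (ℕ → Bool) → (ℕ → Bool) → List ℕ → Binary
marks p q []       = []
marks p q (r ∷ rs) = if p r then false ∷ marks p q rs else if q r then true ∷ marks p q rs else marks p q rs

Disjoint : (ℕ → Bool) → (ℕ → Bool) → Set
Disjoint p q = ∀ r → T (p r) → ¬ T (q r)

infixl 9 _‼_
_‼_ : List ℕ → ℕ → ℕ
[]       ‼ i     = 0
(x ∷ xs) ‼ zero  = x
(x ∷ xs) ‼ suc i = xs ‼ i

module _ (p : ℕ → Bool) where

  ‼-lower : ∀ s m i → i < length (filterᵇ p (range s m)) → s ≤ filterᵇ p (range s m) ‼ i
  ‼-lower s (suc m) i       i<       with p s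
  ‼-lower s (suc m) zero    i<       | true  = ≤-refl
  ‼-lower s (suc m) (suc i) (s≤s i<) | true  = <⇒≤ (‼-lower (suc s) m i i<)
  ‼-lower s (suc m) i       i<       | false = <⇒≤ (‼-lower (suc s) m i i<)

  ‼-upper : ∀ s m i → i < length (filterᵇ p (range s m)) → filterᵇ p (range s m) ‼ i < s + m
  ‼-upper s (suc m) i i< rewrite +-suc s m with p s
  ‼-upper s (suc m) zero    i<       | true  = s≤s (m≤m+n s m)
  ‼-upper s (suc m) (suc i) (s≤s i<) | true  = ‼-upper (suc s) m i i<
  ‼-upper s (suc m) i       i<       | false = ‼-upper (suc s) m i i<

  ‼-increasing : ∀ s m i → suc i < length (filterᵇ p (range s m)) →
                 filterᵇ p (range s m) ‼ i < filterᵇ p (range s m) ‼ suc i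
  ‼-increasing s (suc m) i       i<       with p s
  ‼-increasing s (suc m) zero    (s≤s i<) | true  = ‼-lower (suc s) m 0 i<
  ‼-increasing s (suc m) (suc i) (s≤s i<) | true  = ‼-increasing (suc s) m i i<
  ‼-increasing s (suc m) i       i<       | false = ‼-increasing (suc s) m i i<

count0-marks : ∀ p q rs → count0 (marks p q rs) ≡ length (filterᵇ p rs)
count0-marks p q []       = refl
count0-marks p q (r ∷ rs) with p r | q r
... | true  | _     = cong suc (count0-marks p q rs)
... | false | true  = count0-marks p q rs
... | false | false = count0-marks p q rs

1<4 : 1 < 4
1<4 = s<s z<s

3<4 : 3 < 4
3<4 = s<s (s<s (s<s z<s))

_◁ᴸ_ : List ℕ → List ℕ → Set
ps ◁ᴸ qs = ps ‼ 1 < qs ‼ 0 × ps ‼ 3 < qs ‼ 2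

module _ {p q : ℕ → Bool} (p∩q=∅ : Disjoint p q) where

  private
    absurd-both : ∀ {r} → p r ≡ true → q r ≡ true → ∀ {A : Set} → A
    absurd-both {r} pr qr = ⊥-elim (p∩q=∅ r (subst T (sym pr) tt) (subst T (sym qr) tt))

  count1-marks : ∀ rs → count1 (marks p q rs) ≡ length (filterᵇ q rs)
  count1-marks []       = refl
  count1-marks (r ∷ rs) with p r in pr | q r in qr
  ... | true  | true  = absurd-both pr qr
  ... | true  | false = count1-marks rs
  ... | false | true  = cong suc (count1-marks rs)
  ... | false | false = count1-marks rs

  exchange-marks : ∀ rs → exchange (marks p q rs) ≡ marks q p rs
  exchange-marks []       = refl
  exchange-marks (r ∷ rs) with p r in pr | q r in qr
  ... | true  | true  = absurd-both pr qr
  ... | true  | false = cong (true ∷_) (exchange-marks rs)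
  ... | false | true  = cong (false ∷_) (exchange-marks rs)
  ... | false | false = exchange-marks rs

  occ₀<occ₁-marks : ∀ s m i j → let ps = filterᵇ p (range s m); qs = filterᵇ q (range s m) in
                    i < length ps → j < length qs → T (occ₀<occ₁ (marks p q (range s m)) i j) ⇔ ps ‼ i < qs ‼ j
  occ₀<occ₁-marks s (suc m) i j i< j< with p s in ps | q s in qs
  ... | true | true = absurd-both ps qs
  occ₀<occ₁-marks s (suc m) zero    j       i<       j<       | true  | false =
    mk⇔ (λ _ → ‼-lower q (suc s) m j j<) _
  occ₀<occ₁-marks s (suc m) (suc i) j       (s≤s i<) j<       | true  | false = occ₀<occ₁-marks (suc s) m i j i< j<
  occ₀<occ₁-marks s (suc m) i       zero    i<       j<       | false | true  =
    mk⇔ (λ ()) (λ i<s → <-irrefl refl (<-≤-trans i<s (<⇒≤ (‼-lower p (suc s) m i i<))))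
  occ₀<occ₁-marks s (suc m) i       (suc j) i<       (s≤s j<) | false | true  = occ₀<occ₁-marks (suc s) m i j i< j<
  occ₀<occ₁-marks s (suc m) i       j       i<       j<       | false | false = occ₀<occ₁-marks (suc s) m i j i< j<

  zeroes◁ones-marks : ∀ s m → let ps = filterᵇ p (range s m); qs = filterᵇ q (range s m) in
                      length ps ≡ 4 → length qs ≡ 4 → T (zeroes◁ones (marks p q (range s m))) ⇔ ps ◁ᴸ qs
  zeroes◁ones-marks s m |ps|≡4 |qs|≡4 =
    ⇔-trans T-∧ (occ₀<occ₁-marks s m 1 0 (p-index 1<4) (q-index z<s) ×-⇔
                 occ₀<occ₁-marks s m 3 2 (p-index 3<4) (q-index (s<s (s<s z<s))))
    where
    p-index : ∀ {i} → i < 4 → i < length (filterᵇ p (range s m))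
    p-index {i} = subst (i <_) (sym |ps|≡4)
    q-index : ∀ {i} → i < 4 → i < length (filterᵇ q (range s m))
    q-index {i} = subst (i <_) (sym |qs|≡4)

marks-LTrap⇔Intersect : ∀ {p q} → Disjoint p q → ∀ s m S S′ →
  let ps = filterᵇ p (range s m); qs = filterᵇ q (range s m) in
  length ps ≡ 4 → length qs ≡ 4 → ps ◁ᴸ qs ⇔ S ◁ S′ → qs ◁ᴸ ps ⇔ S′ ◁ S →
  LTrap (marks p q (range s m)) ⇔ Intersect S S′
marks-LTrap⇔Intersect {p} {q} p∩q=∅ s m S S′ |ps|≡4 |qs|≡4 ps◁qs⇔S◁S′ qs◁ps⇔S′◁S = begin
  LTrap bw                                                  ≈⟨ LTrap⇔Unseparated bw |bw|₀≡4 |bw|₁≡4 ⟩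
  (¬ T (zeroes◁ones bw) × ¬ T (zeroes◁ones (exchange bw)))  ≈⟨ ¬-cong-⇔ zeroes◁ones⇔ ×-⇔ ¬-cong-⇔ ones◁zeroes⇔ ⟩
  (¬ S ◁ S′ × ¬ S′ ◁ S)                                     ≈⟨ Intersect⇔¬◁ S S′ ⟨
  Intersect S S′                                            ∎
  where
  open import Relation.Binary.Reasoning.Setoid (⇔-setoid 0ℓ)
  bw : Binary
  bw = marks p q (range s m)
  |bw|₀≡4 : count0 bw ≡ 4
  |bw|₀≡4 = trans (count0-marks p q (range s m)) |ps|≡4
  |bw|₁≡4 : count1 bw ≡ 4
  |bw|₁≡4 = trans (count1-marks p∩q=∅ (range s m)) |qs|≡4
  zeroes◁ones⇔ : T (zeroes◁ones bw) ⇔ S ◁ S′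
  zeroes◁ones⇔ = ⇔-trans (zeroes◁ones-marks p∩q=∅ s m |ps|≡4 |qs|≡4) ps◁qs⇔S◁S′
  ones◁zeroes⇔ : T (zeroes◁ones (exchange bw)) ⇔ S′ ◁ S
  ones◁zeroes⇔ rewrite exchange-marks p∩q=∅ (range s m) =
    ⇔-trans (zeroes◁ones-marks (λ r qr pr → p∩q=∅ r pr qr) s m |qs|≡4 |ps|≡4) qs◁ps⇔S′◁S

marks-range-suc : ∀ p q s m → marks p q (range (suc s) m) ≡ marks (p ∘ suc) (q ∘ suc) (range s m)
marks-range-suc p q s zero    = refl
marks-range-suc p q s (suc m) with p (suc s) | q (suc s)
... | true  | _     = cong (false ∷_) (marks-range-suc p q (suc s) m)
... | false | true  = cong (true ∷_) (marks-range-suc p q (suc s) m)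
... | false | false = marks-range-suc p q (suc s) m

marks-filterᵇ : ∀ p q o rs → marks p q (filterᵇ o rs) ≡ marks (λ r → o r ∧ p r) (λ r → o r ∧ q r) rs
marks-filterᵇ p q o []       = refl
marks-filterᵇ p q o (r ∷ rs) with o r
... | false = marks-filterᵇ p q o rs
... | true with p r | q r
...   | true  | _     = cong (false ∷_) (marks-filterᵇ p q o rs)
...   | false | true  = cong (true ∷_) (marks-filterᵇ p q o rs)
...   | false | false = marks-filterᵇ p q o rs

Ascending : ℕ → List ℕ → ℕ → Set
Ascending s []       e = ⊤
Ascending s (x ∷ xs) e = s ≤ x × x < e × Ascending (suc x) xs e

∉-Ascending : ∀ {s e r} xs → Ascending s xs e → r < s → r ∉ xs
∉-Ascending (x ∷ xs) (s≤x , _ , _)   r<s (here refl)  = <-irrefl refl (<-≤-trans r<s s≤x)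
∉-Ascending (x ∷ xs) (s≤x , _ , xs↑) r<s (there r∈xs) = ∉-Ascending xs xs↑ (<-≤-trans r<s (≤-trans s≤x (n≤1+n x))) r∈xs

filterᵇ-range≡ : ∀ {p} s m xs → Ascending s xs (s + m) → (∀ r → s ≤ r → T (p r) ⇔ r ∈ xs) →
                 filterᵇ p (range s m) ≡ xs
filterᵇ-range≡ s zero []       _                 _ = refl
filterᵇ-range≡ s zero (x ∷ xs) (s≤x , x<s+0 , _) _ =
  ⊥-elim (<-irrefl refl (<-≤-trans x<s+0 (subst (_≤ x) (sym (+-identityʳ s)) s≤x)))
filterᵇ-range≡ {p} s (suc m) xs xs↑ spec with p s | spec s ≤-refl
filterᵇ-range≡ {p} s (suc m) [] _ spec | true | ps⇔s∈xs with Equivalence.to ps⇔s∈xs tt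
... | ()
filterᵇ-range≡ {p} s (suc m) (x ∷ xs) (s≤x , _ , xs↑) spec | true | ps⇔s∈xs with Equivalence.to ps⇔s∈xs tt
... | here refl  = cong (s ∷_) (filterᵇ-range≡ (suc s) m xs (subst (Ascending (suc s) xs) (+-suc s m) xs↑) spec′)
  where
  spec′ : ∀ r → suc s ≤ r → T (p r) ⇔ r ∈ xs
  spec′ r s<r = ⇔-trans (spec r (<⇒≤ s<r)) (mk⇔ (λ { (here refl) → ⊥-elim (<-irrefl refl s<r) ; (there r∈xs) → r∈xs }) there)
... | there s∈xs = ⊥-elim (∉-Ascending xs xs↑ (s≤s s≤x) s∈xs)
filterᵇ-range≡ {p} s (suc m) xs xs↑ spec | false | ps⇔s∈xs =
  filterᵇ-range≡ (suc s) m xs (subst (Ascending (suc s) xs) (+-suc s m) (raise xs (Equivalence.from ps⇔s∈xs) xs↑))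
                 (λ r s<r → spec r (<⇒≤ s<r))
  where
  raise : ∀ ys → s ∉ ys → Ascending s ys (s + suc m) → Ascending (suc s) ys (s + suc m)
  raise []       _    _                 = tt
  raise (y ∷ ys) s∉ys (s≤y , y<e , ys↑) = ≤∧≢⇒< s≤y (s∉ys ∘ here) , y<e , ys↑

occursAt : ∀ {k} → List (Fin k) → Fin k → ℕ → Bool
occursAt []      x r       = false
occursAt (z ∷ w) x zero    = ⌊ z ≟ x ⌋
occursAt (z ∷ w) x (suc r) = occursAt w x r

h≡marks : ∀ {k} (x y : Fin k) w → h x y w ≡ marks (occursAt w x) (occursAt w y) (range 0 (length w))
h≡marks x y []      = refl
h≡marks x y (z ∷ w) with z ≟ x | z ≟ y
... | yes _ | _     = cong (false ∷_) (trans (h≡marks x y w) (sym (marks-range-suc _ _ 0 (length w))))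
... | no _  | yes _ = cong (true ∷_) (trans (h≡marks x y w) (sym (marks-range-suc _ _ 0 (length w))))
... | no _  | no _  = trans (h≡marks x y w) (sym (marks-range-suc _ _ 0 (length w)))

occursAt-disjoint : ∀ {k} {x y : Fin k} → x ≢ y → ∀ w → Disjoint (occursAt w x) (occursAt w y)
occursAt-disjoint x≢y (z ∷ w) (suc r) = occursAt-disjoint x≢y w r
occursAt-disjoint {x = x} {y} x≢y (z ∷ w) zero with z ≟ x | z ≟ y
... | yes refl | yes refl = λ _ _ → x≢y refl
... | yes _    | no _     = λ _ ()
... | no _     | _        = λ ()

h-map : ∀ {k} (f : ℕ → Fin k) x y rs → h x y (map f rs) ≡ marks (λ r → ⌊ f r ≟ x ⌋) (λ r → ⌊ f r ≟ y ⌋) rs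
h-map f x y []       = refl
h-map f x y (r ∷ rs) with f r ≟ x | f r ≟ y
... | yes _ | _     = cong (false ∷_) (h-map f x y rs)
... | no _  | yes _ = cong (true ∷_) (h-map f x y rs)
... | no _  | no _  = h-map f x y rs

-- From words to trapezoids

toℚ : ℕ → ℚ
toℚ n = mkℚ (+ n) 0 (coprime-sym (1-coprimeTo n))

toℚ-mono-≤ : ∀ {m n} → m ≤ n → toℚ m ℚ.≤ toℚ n
toℚ-mono-≤ {m} {n} m≤n = *≤* (subst₂ ℤ._≤_ (sym (*-identityʳ (+ m))) (sym (*-identityʳ (+ n))) (+≤+ m≤n))

toℚ-<⇔ : ∀ {m n} → toℚ m ℚ.< toℚ n ⇔ m < n
toℚ-<⇔ {m} {n} = mk⇔
  (λ { (*<* m<n) → drop‿+<+ (subst₂ ℤ._<_ (*-identityʳ (+ m)) (*-identityʳ (+ n)) m<n) })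
  (λ m<n → *<* (subst₂ ℤ._<_ (sym (*-identityʳ (+ m))) (sym (*-identityʳ (+ n))) (+<+ m<n)))

ℕ-trapezoid : ∀ {p₀ p₁ p₂ p₃} → p₀ ≤ p₁ → p₂ ≤ p₃ → Trapezoid
ℕ-trapezoid {p₀} {p₁} {p₂} {p₃} p₀≤p₁ p₂≤p₃ = record
  { a = toℚ p₀ ; b = toℚ p₁ ; c = toℚ p₂ ; d = toℚ p₃ ; a≤b = toℚ-mono-≤ p₀≤p₁ ; c≤d = toℚ-mono-≤ p₂≤p₃ }

module FromWord {k} (w : List (Fin k)) where

  L : ℕ
  L = length w

  positions : Fin k → List ℕ
  positions x = filterᵇ (occursAt w x) (range 0 L)

  quad : ∀ x → length (positions x) ≡ 4 → Trapezoid
  quad x |x|≡4 = ℕ-trapezoid (<⇒≤ (‼-increasing (occursAt w x) 0 L 0 (subst (1 <_) (sym |x|≡4) 1<4)))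
                             (<⇒≤ (‼-increasing (occursAt w x) 0 L 2 (subst (3 <_) (sym |x|≡4) 3<4)))

  -- Letters not occurring exactly four times are isolated vertices; they become pairwise
  -- distinct points to the right of all positions.
  point : Fin k → Trapezoid
  point x = ℕ-trapezoid (≤-refl {L + toℕ x}) (≤-refl {L + toℕ x})

  trapezoid : Fin k → Trapezoid
  trapezoid x with length (positions x) ≟ℕ 4
  ... | yes |x|≡4 = quad x |x|≡4
  ... | no _      = point x

  quad◁point : ∀ x |x|≡4 y → quad x |x|≡4 ◁ point y
  quad◁point x |x|≡4 y = below-point 1 1<4 , below-point 3 3<4
    where
    below-point : ∀ i → i < 4 → toℚ (positions x ‼ i) ℚ.< toℚ (L + toℕ y)
    below-point i i<4 = Equivalence.from toℚ-<⇔
      (<-≤-trans (‼-upper (occursAt w x) 0 L i (subst (i <_) (sym |x|≡4) i<4)) (m≤m+n L (toℕ y)))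

  ¬Intersect-point : ∀ x y → x ≢ y → ¬ Intersect (point x) (point y)
  ¬Intersect-point x y x≢y i with <-cmp (toℕ x) (toℕ y)
  ... | tri< x<y _ _ = Intersect⇒¬◁ {point x} {point y} i (x◁y , x◁y)
    where
    x◁y : toℚ (L + toℕ x) ℚ.< toℚ (L + toℕ y)
    x◁y = Equivalence.from toℚ-<⇔ (+-monoʳ-< L x<y)
  ... | tri≈ _ x≡y _ = x≢y (toℕ-injective x≡y)
  ... | tri> _ _ y<x = Intersect⇒¬◁ {point y} {point x} (Intersect-sym {point x} {point y} i) (y◁x , y◁x)
    where
    y◁x : toℚ (L + toℕ y) ℚ.< toℚ (L + toℕ x)
    y◁x = Equivalence.from toℚ-<⇔ (+-monoʳ-< L y<x)

  count0-h : ∀ x y → count0 (h x y w) ≡ length (positions x)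
  count0-h x y = trans (cong count0 (h≡marks x y w)) (count0-marks (occursAt w x) (occursAt w y) (range 0 L))

  count1-h : ∀ {x y} → x ≢ y → count1 (h x y w) ≡ length (positions y)
  count1-h {x} {y} x≢y = trans (cong count1 (h≡marks x y w)) (count1-marks (occursAt-disjoint x≢y w) (range 0 L))

  LTrap⇔Intersect : ∀ x y → x ≢ y → LTrap (h x y w) ⇔ Intersect (trapezoid x) (trapezoid y)
  LTrap⇔Intersect x y x≢y with length (positions x) ≟ℕ 4 | length (positions y) ≟ℕ 4
  ... | yes |x|≡4 | yes |y|≡4 =
    subst (λ bw → LTrap bw ⇔ Intersect (quad x |x|≡4) (quad y |y|≡4)) (sym (h≡marks x y w))
      (marks-LTrap⇔Intersect (occursAt-disjoint x≢y w) 0 L (quad x |x|≡4) (quad y |y|≡4) |x|≡4 |y|≡4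
                             (⇔-sym (toℚ-<⇔ ×-⇔ toℚ-<⇔)) (⇔-sym (toℚ-<⇔ ×-⇔ toℚ-<⇔)))
  ... | yes |x|≡4 | no |y|≢4  =
    empty⇔empty (|y|≢4 ∘ trans (sym (count1-h x≢y)) ∘ LTrap⇒count1≡4)
                (λ i → Intersect⇒¬◁ {quad x |x|≡4} {point y} i (quad◁point x |x|≡4 y))
  ... | no |x|≢4  | yes |y|≡4 =
    empty⇔empty (|x|≢4 ∘ trans (sym (count0-h x y)) ∘ LTrap⇒count0≡4)
                (λ i → Intersect⇒¬◁ {quad y |y|≡4} {point x} (Intersect-sym {point x} {quad y |y|≡4} i)
                                    (quad◁point y |y|≡4 x))
  ... | no |x|≢4  | no _      =
    empty⇔empty (|x|≢4 ∘ trans (sym (count0-h x y)) ∘ LTrap⇒count0≡4) (¬Intersect-point x y x≢y)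

-- From trapezoids to words

module _ {A : Set} {P Q : A → Set} (P? : Decidable P) (Q? : Decidable Q) (P⊆Q : ∀ {v} → P v → Q v) where

  length-filter-mono : ∀ vs → length (filter P? vs) ≤ length (filter Q? vs)
  length-filter-mono []       = z≤n
  length-filter-mono (v ∷ vs) with P? v | Q? v
  ... | yes _  | yes _  = s≤s (length-filter-mono vs)
  ... | yes Pv | no ¬Qv = ⊥-elim (¬Qv (P⊆Q Pv))
  ... | no _   | yes _  = m≤n⇒m≤1+n (length-filter-mono vs)
  ... | no _   | no _   = length-filter-mono vs

  length-filter-mono-< : ∀ {z} vs → z ∈ vs → ¬ P z → Q z → length (filter P? vs) < length (filter Q? vs)
  length-filter-mono-< (v ∷ vs) (here refl) ¬Pv Qv with P? v | Q? v
  ... | yes Pv | _      = ⊥-elim (¬Pv Pv)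
  ... | no _   | yes _  = s≤s (length-filter-mono vs)
  ... | no _   | no ¬Qv = ⊥-elim (¬Qv Qv)
  length-filter-mono-< (v ∷ vs) (there z∈vs) ¬Pz Qz with P? v | Q? v
  ... | yes _  | yes _  = s≤s (length-filter-mono-< vs z∈vs ¬Pz Qz)
  ... | yes Pv | no ¬Qv = ⊥-elim (¬Qv (P⊆Q Pv))
  ... | no _   | yes _  = m<n⇒m<1+n (length-filter-mono-< vs z∈vs ¬Pz Qz)
  ... | no _   | no _   = length-filter-mono-< vs z∈vs ¬Pz Qz

countBelow : List ℚ → ℚ → ℕ
countBelow vs x = length (filter (_<? x) vs)

countBelow≤length : ∀ vs x → countBelow vs x ≤ length vs
countBelow≤length vs x = length-filter (_<? x) vs

countBelow-mono-≤ : ∀ vs {x y} → x ℚ.≤ y → countBelow vs x ≤ countBelow vs y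
countBelow-mono-≤ vs {x} {y} x≤y = length-filter-mono (_<? x) (_<? y) (λ v<x → ℚ.<-≤-trans v<x x≤y) vs

countBelow-mono-< : ∀ vs {x y} → x ∈ vs → x ℚ.< y → countBelow vs x < countBelow vs y
countBelow-mono-< vs {x} {y} x∈vs x<y =
  length-filter-mono-< (_<? x) (_<? y) (λ v<x → ℚ.<-trans v<x x<y) vs x∈vs (ℚ.<-irrefl refl) x<y

countBelow-<⇔ : ∀ vs {x y} → x ∈ vs → countBelow vs x < countBelow vs y ⇔ x ℚ.< y
countBelow-<⇔ vs {x} {y} x∈vs = mk⇔ cancel (countBelow-mono-< vs x∈vs)
  where
  cancel : countBelow vs x < countBelow vs y → x ℚ.< y
  cancel cx<cy with x <? y
  ... | yes x<y = x<y
  ... | no x≮y  = ⊥-elim (<⇒≱ cx<cy (countBelow-mono-≤ vs (ℚ.≮⇒≥ x≮y)))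

odd<even⇔ : ∀ x y → suc (2 * x) < 2 * y ⇔ x < y
odd<even⇔ x y = mk⇔ (λ 1+2x<2y → *-cancelˡ-< 2 x y (<-trans (n<1+n (2 * x)) 1+2x<2y))
                    (λ x<y → <-≤-trans (n<1+n (suc (2 * x))) (subst (_≤ 2 * y) (*-suc 2 x) (*-monoʳ-≤ 2 x<y)))

module Keys {N : ℕ} .{{_ : NonZero N}} where

  key : Fin N → ℕ → ℕ
  key u s = toℕ u + s * N

  key<*N : ∀ u {s t} → s < t → key u s < t * N
  key<*N u {s} s<t = <-≤-trans (+-monoˡ-< (s * N) (toℕ<n u)) (*-monoˡ-≤ N s<t)

  key-mono-< : ∀ u v {s t} → s < t → key u s < key v t
  key-mono-< u v {s} {t} s<t = <-≤-trans (key<*N u s<t) (m≤n+m (t * N) (toℕ v))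

  key-<⇔ : ∀ u v {s t} → s ≢ t → key u s < key v t ⇔ s < t
  key-<⇔ u v {s} {t} s≢t = mk⇔ cancel (key-mono-< u v)
    where
    cancel : key u s < key v t → s < t
    cancel k<k with <-cmp s t
    ... | tri< s<t _ _ = s<t
    ... | tri≈ _ s≡t _ = ⊥-elim (s≢t s≡t)
    ... | tri> _ _ t<s = ⊥-elim (<-asym k<k (key-mono-< v u t<s))

  key%N : ∀ u s → key u s % N ≡ toℕ u
  key%N u s = trans ([m+kn]%n≡m%n (toℕ u) s N) (m<n⇒m%n≡m (toℕ<n u))

  right<left⇔ : ∀ B u v x y → key u (B + suc (2 * x)) < key v (B + 2 * y) ⇔ x < y
  right<left⇔ B u v x y =
    ⇔-trans (key-<⇔ u v (λ eq → even≢odd y x (sym (+-cancelˡ-≡ B _ _ eq))))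
            (⇔-trans (mk⇔ (+-cancelˡ-< B _ _) (+-monoʳ-< B)) (odd<even⇔ x y))

module ToWord {N : ℕ} .{{_ : NonZero N}} (τ : Fin N → Trapezoid) where

  open Keys {N}

  tops bottoms : List ℚ
  tops    = map (a ∘ τ) (allFin N) ++ map (b ∘ τ) (allFin N)
  bottoms = map (c ∘ τ) (allFin N) ++ map (d ∘ τ) (allFin N)

  offset : ℕ
  offset = 2 + 2 * length tops

  -- An endpoint is placed by the number of endpoint values below it on its line: left endpoints
  -- in even and right endpoints in odd slots, so that at equal values the left endpoint comes
  -- first and touching trapezoids still intersect; the bottom line starts after the top line.
  -- Distinct vertices get distinct keys u + s * N in the same slot s.
  slots : Fin N → List ℕ
  slots u = 2 * countBelow tops (a (τ u)) ∷ suc (2 * countBelow tops (b (τ u)))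
          ∷ offset + 2 * countBelow bottoms (c (τ u)) ∷ offset + suc (2 * countBelow bottoms (d (τ u))) ∷ []

  keys : Fin N → List ℕ
  keys u = map (key u) (slots u)

  bound : ℕ
  bound = suc (offset + suc (2 * length bottoms)) * N

  letter : ℕ → Fin N
  letter r = fromℕ< (m%n<n r N)

  occupied : ℕ → Bool
  occupied r = ⌊ r ∈? keys (letter r) ⌋
    where open import Data.List.Membership.DecPropositional _≟ℕ_ using (_∈?_)

  word : List (Fin N)
  word = map letter (filterᵇ occupied (range 0 bound))

  isKey : Fin N → ℕ → Bool
  isKey u r = occupied r ∧ ⌊ letter r ≟ u ⌋

  letter-key : ∀ u s → letter (key u s) ≡ u
  letter-key u s = toℕ-injective (trans (toℕ-fromℕ< (m%n<n (key u s) N)) (key%N u s))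

  ∈keys⇒letter : ∀ {u r} → r ∈ keys u → letter r ≡ u
  ∈keys⇒letter {u} r∈keys with ∈-map⁻ (key u) {xs = slots u} r∈keys
  ... | s , _ , refl = letter-key u s

  isKey⇔∈keys : ∀ {u r} → T (isKey u r) ⇔ r ∈ keys u
  isKey⇔∈keys {u} {r} = mk⇔ to from
    where
    to : T (isKey u r) → r ∈ keys u
    to isKey-ur with Equivalence.to (T-∧ {occupied r}) isKey-ur
    ... | occ , letter≡ = subst (λ v → r ∈ keys v) (toWitness {a? = letter r ≟ u} letter≡) (toWitness occ)
    from : r ∈ keys u → T (isKey u r)
    from r∈keys = Equivalence.from (T-∧ {occupied r})
      ( fromWitness (subst (λ v → r ∈ keys v) (sym (∈keys⇒letter r∈keys)) r∈keys)
      , fromWitness {a? = letter r ≟ u} (∈keys⇒letter r∈keys))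

  isKey-disjoint : ∀ {u v} → u ≢ v → Disjoint (isKey u) (isKey v)
  isKey-disjoint u≢v r isKey-ur isKey-vr = u≢v (trans (sym (isKey⇒letter isKey-ur)) (isKey⇒letter isKey-vr))
    where
    isKey⇒letter : ∀ {w} → T (isKey w r) → letter r ≡ w
    isKey⇒letter {w} = toWitness {a? = letter r ≟ w} ∘ proj₂ ∘ Equivalence.to (T-∧ {occupied r})

  h-word : ∀ u v → h u v word ≡ marks (isKey u) (isKey v) (range 0 bound)
  h-word u v = trans (h-map letter u v (filterᵇ occupied (range 0 bound)))
                     (marks-filterᵇ (λ r → ⌊ letter r ≟ u ⌋) (λ r → ⌊ letter r ≟ v ⌋) occupied (range 0 bound))

  keys-ascending : ∀ u → Ascending 0 (keys u) bound
  keys-ascending u =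
    z≤n , <-trans k₀<k₁ (<-trans k₁<k₂ (<-trans k₂<k₃ k₃<bound)) ,
    k₀<k₁ , <-trans k₁<k₂ (<-trans k₂<k₃ k₃<bound) ,
    k₁<k₂ , <-trans k₂<k₃ k₃<bound ,
    k₂<k₃ , k₃<bound , tt
    where
    k₀<k₁ : keys u ‼ 0 < keys u ‼ 1
    k₀<k₁ = key-mono-< u u (s≤s (*-monoʳ-≤ 2 (countBelow-mono-≤ tops (a≤b (τ u)))))
    k₁<k₂ : keys u ‼ 1 < keys u ‼ 2
    k₁<k₂ = key-mono-< u u (≤-trans (s≤s (s≤s (*-monoʳ-≤ 2 (countBelow≤length tops (b (τ u))))))
                                     (m≤m+n offset (2 * countBelow bottoms (c (τ u)))))
    k₂<k₃ : keys u ‼ 2 < keys u ‼ 3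
    k₂<k₃ = key-mono-< u u (+-monoʳ-< offset (s≤s (*-monoʳ-≤ 2 (countBelow-mono-≤ bottoms (c≤d (τ u))))))
    k₃<bound : keys u ‼ 3 < bound
    k₃<bound = key<*N u (s≤s (+-monoʳ-≤ offset (s≤s (*-monoʳ-≤ 2 (countBelow≤length bottoms (d (τ u)))))))

  filterᵇ-isKey : ∀ u → filterᵇ (isKey u) (range 0 bound) ≡ keys u
  filterᵇ-isKey u = filterᵇ-range≡ 0 bound (keys u) (keys-ascending u) (λ r _ → isKey⇔∈keys)

  keys◁ᴸ⇔ : ∀ u v → keys u ◁ᴸ keys v ⇔ τ u ◁ τ v
  keys◁ᴸ⇔ u v = ⇔-trans (right<left⇔ 0 u v _ _) (countBelow-<⇔ tops b∈tops)
            ×-⇔ ⇔-trans (right<left⇔ offset u v _ _) (countBelow-<⇔ bottoms d∈bottoms)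
    where
    b∈tops : b (τ u) ∈ tops
    b∈tops = ∈-++⁺ʳ (map (a ∘ τ) (allFin N)) (∈-map⁺ (b ∘ τ) (∈-allFin u))
    d∈bottoms : d (τ u) ∈ bottoms
    d∈bottoms = ∈-++⁺ʳ (map (c ∘ τ) (allFin N)) (∈-map⁺ (d ∘ τ) (∈-allFin u))

  LTrap⇔Intersect : ∀ u v → u ≢ v → LTrap (h u v word) ⇔ Intersect (τ u) (τ v)
  LTrap⇔Intersect u v u≢v =
    subst (λ bw → LTrap bw ⇔ Intersect (τ u) (τ v)) (sym (h-word u v))
      (marks-LTrap⇔Intersect (isKey-disjoint u≢v) 0 bound (τ u) (τ v)
        (cong length (filterᵇ-isKey u)) (cong length (filterᵇ-isKey v))
        (subst₂ (λ ps qs → ps ◁ᴸ qs ⇔ τ u ◁ τ v) (sym (filterᵇ-isKey u)) (sym (filterᵇ-isKey v)) (keys◁ᴸ⇔ u v))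
        (subst₂ (λ qs ps → qs ◁ᴸ ps ⇔ τ v ◁ τ u) (sym (filterᵇ-isKey v)) (sym (filterᵇ-isKey u)) (keys◁ᴸ⇔ v u)))

  ∈-word : ∀ u → u ∈ word
  ∈-word u = subst (_∈ word) (letter-key u s₀) (∈-map⁺ letter (∈-filter⁺ (T? ∘ occupied) k∈range k-occupied))
    where
    s₀ k : ℕ
    s₀ = 2 * countBelow tops (a (τ u))
    k = key u s₀
    k∈range : k ∈ range 0 bound
    k∈range = proj₁ (∈-filter⁻ (T? ∘ isKey u) {xs = range 0 bound} (subst (k ∈_) (sym (filterᵇ-isKey u)) (here refl)))
    k-occupied : T (occupied k)
    k-occupied = fromWitness (subst (λ v → k ∈ keys v) (sym (letter-key u s₀)) (here refl))

-- Graphs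

word-representation : ∀ N (τ : Fin N → Trapezoid) → Σ (List (Fin N)) λ w →
  (∀ u → u ∈ w) × (∀ u v → u ≢ v → LTrap (h u v w) ⇔ Intersect (τ u) (τ v))
word-representation zero    τ = [] , (λ ()) , (λ ())
word-representation (suc N) τ = ToWord.word τ , ToWord.∈-word τ , ToWord.LTrap⇔Intersect τ

≢×⇔ : ∀ {A B : Set} {x y : A} → x ≢ y → (x ≢ y × B) ⇔ B
≢×⇔ x≢y = mk⇔ proj₂ (x≢y ,_)

InClass⇒IsTrapezoidGraph : ∀ G → InClass LTrap G → IsTrapezoidGraph G
InClass⇒IsTrapezoidGraph G (k , w , _ , f , adj⇔) = trapezoid ∘ to , adj⇔Intersect
  where
  open FromWord w
  open Inverse f using (to)
  adj⇔Intersect : ∀ u v → u ≢ v → Adj G u v ⇔ Intersect (trapezoid (to u)) (trapezoid (to v))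
  adj⇔Intersect u v u≢v = ⇔-trans (adj⇔ u v) (⇔-trans (≢×⇔ to-u≢to-v) (LTrap⇔Intersect (to u) (to v) to-u≢to-v))
    where
    to-u≢to-v : to u ≢ to v
    to-u≢to-v = u≢v ∘ Injection.injective (↔⇒↣ f)

IsTrapezoidGraph⇒InClass : ∀ G → IsTrapezoidGraph G → InClass LTrap G
IsTrapezoidGraph⇒InClass G (τ , adj⇔Intersect) with word-representation (n G) τ
... | w , w-covers , LTrap⇔Intersect = n G , w , w-covers , ↔-refl , adj⇔
  where
  adj⇔ : ∀ u v → Adj G u v ⇔ WordAdj LTrap w u v
  adj⇔ u v with u ≟ v
  ... | yes refl = empty⇔empty (irrefl G) (λ (u≢u , _) → u≢u refl)
  ... | no u≢v   = ⇔-trans (adj⇔Intersect u v u≢v) (⇔-trans (⇔-sym (LTrap⇔Intersect u v u≢v)) (⇔-sym (≢×⇔ u≢v)))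

theorem5 : (G : Graph) → InClass LTrap G ⇔ IsTrapezoidGraph G
theorem5 G = mk⇔ (InClass⇒IsTrapezoidGraph G) (IsTrapezoidGraph⇒InClass G)
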